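{- Let $n\ge 1$ and let $P$ be an $n\times n$ Petrie matrix, with its $r$-th row written as $v[a_r,b_r]$ ($0\le a_r\le b_r\le n$) for $r=1,\dots,n$. Then \[ \det(P)=\sum_{\sigma\ \text{good}} (-1)^{|\sigma|+\operatorname{inv}(\sigma)}, \] where the sum runs over all good orientations $\sigma$ of $P$.
   Context: For integers $0\le a\le b\le n$, $v[a,b]$ denotes the row vector of length $n$ whose entries in positions $a+1,\dots,b$ are $1$ and whose other entries are $0$. An $n\times n$ Petrie matrix is a $0/1$ matrix each of whose rows is of the form $v[a,b]$ for some $0\le a\le b\le n$; for each row $r$ one fixes such a representation $v[a_r,b_r]$ (for a zero row any $a_r=b_r$). The Petrie graph of $P$ is the multigraph on vertex set $\{0,1,\dots,n\}$ having, for each row $r$, one edge $\{a_r,b_r\}$ (a self-loop if $a_r=b_r$). An orientation $\sigma$ of $P$ chooses, for each row $r$, either the unreversed pair $(c_r,d_r)=(a_r,b_r)$ or the reversed pair $(c_r,d_r)=(b_r,a_r)$; these are regarded as two distinct choices even when $a_r=b_r$. The orientation is good if $(c_1,\dots,c_n)$ is a permutation of $\{0,1,\dots,n-1\}$ (equivalently, in the Petrie graph every vertex other than $n$ has exactly one outgoing edge and vertex $n$ has none). Its size $|\sigma|$ is the number of reversed rows, and $\operatorname{inv}(\sigma)=\#\{(r,s): 1\le r<s\le n,\ c_r>c_s\}$ is the number of inversions of the word $c_1c_2\cdots c_n$. -}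

module Defs where

open import Data.Nat as ℕ using (ℕ; zero; suc; _≤_; _<_; _<?_; _≤?_)
open import Data.Integer as ℤ using (ℤ; +_; -_)
open import Data.Fin using (Fin; zero; suc; toℕ; punchIn)
open import Data.Bool using (Bool; true; false; if_then_else_)
open import Data.List using (List; []; _∷_; map; concatMap; allFin; upTo; length; filter; foldr; _++_)
open import Data.List.Relation.Binary.Permutation.Propositional using (_↭_)
open import Relation.Nullary.Decidable using (_×-dec_)
open import Data.Product using (_×_)

sgn : ℕ → ℤ
sgn zero = + 1
sgn (suc k) = - sgn k

sumℤ : List ℤ → ℤ
sumℤ = foldr ℤ._+_ (+ 0)

det : (n : ℕ) → (Fin n → Fin n → ℤ) → ℤ
det zero M = + 1
det (suc n) M =
  sumℤ (map (λ j → sgn (toℕ j) ℤ.* (M zero j ℤ.* det n (λ r s → M (suc r) (punchIn j s))))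
            (allFin (suc n)))

-- The Petrie matrix with rows v[a r, b r]: entry (r, j) (j 0-based, position j+1)
-- is 1 iff a r < j+1 ≤ b r.
petrie : (n : ℕ) → (a b : Fin n → ℕ) → Fin n → Fin n → ℤ
petrie n a b r j with (a r ≤? toℕ j) ×-dec (toℕ j <? b r)
... | Relation.Nullary.Decidable.yes _ = + 1
... | Relation.Nullary.Decidable.no _ = + 0

-- An orientation: for each row, true = reversed, false = unreversed.
Orientation : ℕ → Set
Orientation n = Fin n → Bool

allOrientations : (n : ℕ) → List (Orientation n)
allOrientations zero = (λ ()) ∷ []
allOrientations (suc n) =
  concatMap (λ σ → (λ { zero → false ; (suc r) → σ r }) ∷ (λ { zero → true ; (suc r) → σ r }) ∷ [])
            (allOrientations n)

cOf : {n : ℕ} → (a b : Fin n → ℕ) → Orientation n → Fin n → ℕ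
cOf a b σ r = if σ r then b r else a r

cWord : {n : ℕ} → (a b : Fin n → ℕ) → Orientation n → List ℕ
cWord {n} a b σ = map (cOf a b σ) (allFin n)

Good : {n : ℕ} → (a b : Fin n → ℕ) → Orientation n → Set
Good {n} a b σ = cWord a b σ ↭ upTo n

size : {n : ℕ} → Orientation n → ℕ
size {n} σ = length (filter (λ r → σ r Data.Bool.≟ true) (allFin n))

inversions : List ℕ → ℕ
inversions [] = 0
inversions (x ∷ xs) = length (filter (λ y → y <? x) xs) ℕ.+ inversions xs

inv : {n : ℕ} → (a b : Fin n → ℕ) → Orientation n → ℕ
inv a b σ = inversions (cWord a b σ)

-- Both sides satisfy the same recursion on the first row v[a₀, b₀]: they equal
-- T(a₀) − T(b₀), where T(x) is (−1)^x times the same quantity for the remaining rows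
-- after merging vertex x into the sink n.  For the determinant, expanding along row 0 and
-- deleting column j identifies the vertices j and j+1, and the alternating sum over
-- a₀ ≤ j < b₀ telescopes to T(a₀) − T(b₀): each step T(j) − T(j+1) is an instance of the
-- additivity of the signed count when a vertex is split into two.  For the orientations,
-- letting row 0 start at x ∈ {a₀, b₀} costs one reversal if x = b₀, the first letter x of
-- a permutation of 0, …, n−1 creates exactly x inversions, and the good orientations of
-- the remaining rows are exactly those of the graph with x merged into the sink n.
module Submission where

open import Defs
open import Data.Bool using (Bool; true; false; if_then_else_; _∧_)
import Data.Bool as Bool
open import Data.Bool.Properties using (if-float)
open import Data.Empty using (⊥-elim)
open import Data.Fin using (Fin; zero; suc; toℕ; punchIn)
open import Data.Fin.Properties using (toℕ<n)
open import Data.Integer as ℤ using (ℤ; +_; -_)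
import Data.Integer.Properties as ℤ
open import Data.Integer.Tactic.RingSolver using (solve-∀)
open import Data.List using (List; []; _∷_; map; filter; concatMap; allFin; tabulate; upTo; length; _++_)
open import Data.List.Properties
  using ( map-∘; map-cong; map-id; map-id-local; map-tabulate; tabulate-cong; map-++; map-upTo
        ; filter-accept; filter-reject; filter-none)
open import Data.List.Membership.Propositional.Properties using (∈-upTo⁻)
open import Data.List.Relation.Unary.All as All using (All; []; _∷_)
open import Data.List.Relation.Unary.All.Properties using (map⁻)
open import Data.List.Relation.Unary.Any using (here)
open import Data.List.Relation.Binary.Permutation.Propositional
  using (_↭_; ↭-refl; ↭-reflexive; ↭-prep; ↭-swap; ↭-sym; ↭-trans; module PermutationReasoning)
open import Data.List.Relation.Binary.Permutation.Propositional.Properties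
  using (drop-∷; ↭-length; ∈-resp-↭; map⁺; filter-↭)
open import Data.Nat using (ℕ; zero; suc; _≤_; _<_; _<ᵇ_; _+_; z≤n; s≤s; z<s; pred; _≟_; _<?_; _≤?_)
open import Data.Nat.Properties
  using ( ≤-refl; ≤-trans; <-trans; <-≤-trans; <-cmp; <-irrefl; <⇒≢; <⇒≯; <⇒≱; <⇒≤; n≮n; ≮⇒≥; n<1+n
        ; ≤-pred; <⇒≤pred; pred-mono-≤; m<n⇒m<1+n; m≤n⇒m≤1+n; m≤n⇒m<n∨m≡n; <ᵇ-reflects-<)
import Data.Nat.Tactic.RingSolver as ℕ-Solver
open import Data.Product using (_×_; _,_)
open import Data.Sum using (_⊎_; inj₁; inj₂)
open import Function using (_∘_; id; _⇔_; mk⇔; Equivalence)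
open import Relation.Binary.Definitions using (tri<; tri≈; tri>)
open import Relation.Binary.PropositionalEquality using (_≡_; _≢_; refl; sym; trans; cong; cong₂; module ≡-Reasoning)
open import Relation.Nullary using (¬_; Dec; yes; no; does; ofʸ)
open import Relation.Nullary.Decidable using (dec-true; dec-false; _×-dec_)
open import Relation.Unary using (Decidable)

open Equivalence using (to; from)

<ᵇ-true : ∀ {m n} → m < n → (m <ᵇ n) ≡ true
<ᵇ-true = dec-true (_ <? _)

<ᵇ-false : ∀ {m n} → ¬ m < n → (m <ᵇ n) ≡ false
<ᵇ-false = dec-false (_ <? _)

-- Relabelling vertices

-- contract x m merges vertex x into the sink m and renumbers the other vertices
-- order-preservingly (the ℕ analogue of Fin.punchOut away from x).
contract : ℕ → ℕ → ℕ → ℕ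
contract x m v = if v <ᵇ x then v else if x <ᵇ v then pred v else m

contract-< : ∀ {x m v} → v < x → contract x m v ≡ v
contract-< {x} {m} {v} v<x rewrite <ᵇ-true v<x = refl

contract-self : ∀ {x m} → contract x m x ≡ m
contract-self {x} rewrite <ᵇ-false (n≮n x) = refl

contract-> : ∀ {x m v} → x < v → contract x m v ≡ pred v
contract-> {x} {m} {v} x<v rewrite <ᵇ-false (<⇒≯ x<v) | <ᵇ-true x<v = refl

contract-≢ : ∀ {x m v} → v ≢ x → (v < x × contract x m v ≡ v) ⊎ (x < v × contract x m v ≡ pred v)
contract-≢ {x} {m} {v} v≢x with <-cmp v x
... | tri< v<x _ _ = inj₁ (v<x , contract-< v<x)
... | tri≈ _ v≡x _ = ⊥-elim (v≢x v≡x)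
... | tri> _ _ x<v = inj₂ (x<v , contract-> x<v)

contract-<-sink : ∀ {x m v} → x ≤ m → v ≤ m → v ≢ x → contract x m v < m
contract-<-sink {x} {m} {v} x≤m v≤m v≢x with contract-≢ {m = m} v≢x
... | inj₁ (v<x , eq) rewrite eq = <-≤-trans v<x x≤m
... | inj₂ (s≤s _ , eq) rewrite eq = v≤m

contract-<-sink⇒≢ : ∀ {x m v} → contract x m v < m → v ≢ x
contract-<-sink⇒≢ {x} c<m refl = <-irrefl (contract-self {x}) c<m

contract-monotone : ∀ {x m y z} → y ≢ x → z ≢ x → (z < y ⇔ contract x m z < contract x m y)
contract-monotone {x} {m} y≢x z≢x with contract-≢ {m = m} y≢x | contract-≢ {m = m} z≢x
... | inj₁ (y<x , ey) | inj₁ (z<x , ez) rewrite ey | ez = mk⇔ id id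
... | inj₂ (x<y , ey) | inj₁ (z<x , ez) rewrite ey | ez =
  mk⇔ (λ _ → <-≤-trans z<x (<⇒≤pred x<y)) (λ _ → <-trans z<x x<y)
... | inj₁ (y<x , ey) | inj₂ (x<z , ez) rewrite ey | ez =
  mk⇔ (λ z<y → ⊥-elim (<⇒≯ z<y (<-trans y<x x<z)))
      (λ z′<y → ⊥-elim (<⇒≯ z′<y (<-≤-trans y<x (<⇒≤pred x<z))))
... | inj₂ (s≤s _ , ey) | inj₂ (s≤s _ , ez) rewrite ey | ez = mk⇔ ≤-pred s≤s

punchInℕ : ℕ → ℕ → ℕ
punchInℕ zero v = suc v
punchInℕ (suc x) zero = zero
punchInℕ (suc x) (suc v) = suc (punchInℕ x v)

punchInℕ-< : ∀ {x v} → v < x → punchInℕ x v ≡ v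
punchInℕ-< {suc x} {zero} _ = refl
punchInℕ-< {suc x} {suc v} (s≤s v<x) = cong suc (punchInℕ-< v<x)

punchInℕ-≥ : ∀ {x v} → x ≤ v → punchInℕ x v ≡ suc v
punchInℕ-≥ {zero} _ = refl
punchInℕ-≥ {suc x} {suc v} (s≤s x≤v) = cong suc (punchInℕ-≥ x≤v)

toℕ-punchIn : ∀ {n} (i : Fin (suc n)) (j : Fin n) → toℕ (punchIn i j) ≡ punchInℕ (toℕ i) (toℕ j)
toℕ-punchIn zero j = refl
toℕ-punchIn (suc i) zero = refl
toℕ-punchIn (suc i) (suc j) = cong suc (toℕ-punchIn i j)

contract-punchInℕ : ∀ {x m} v → contract x m (punchInℕ x v) ≡ v
contract-punchInℕ {x} {m} v with v <? x
... | yes v<x rewrite punchInℕ-< v<x = contract-< v<x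
... | no v≮x rewrite punchInℕ-≥ (≮⇒≥ v≮x) = contract-> (s≤s (≮⇒≥ v≮x))

punchInℕ-contract : ∀ {x m v} → v ≢ x → punchInℕ x (contract x m v) ≡ v
punchInℕ-contract {m = m} v≢x with contract-≢ {m = m} v≢x
... | inj₁ (v<x , eq) rewrite eq = punchInℕ-< v<x
... | inj₂ (s≤s x≤v′ , eq) rewrite eq = punchInℕ-≥ x≤v′

contract-injective : ∀ {x m v w} → v ≢ x → contract x m v < m → contract x m w ≡ contract x m v → w ≡ v
contract-injective {x} {m} {v} {w} v≢x c<m eq with w ≟ x
... | yes refl = ⊥-elim (<-irrefl (trans (sym eq) (contract-self {x})) c<m)
... | no w≢x = begin
  w                            ≡⟨ sym (punchInℕ-contract w≢x) ⟩
  punchInℕ x (contract x m w)  ≡⟨ cong (punchInℕ x) eq ⟩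
  punchInℕ x (contract x m v)  ≡⟨ punchInℕ-contract v≢x ⟩
  v                            ∎
  where open ≡-Reasoning

pinchℕ : ℕ → ℕ → ℕ
pinchℕ _ zero = zero
pinchℕ zero (suc v) = v
pinchℕ (suc j) (suc v) = suc (pinchℕ j v)

pinchℕ-≤ : ∀ {j v} → v ≤ j → pinchℕ j v ≡ v
pinchℕ-≤ {v = zero} _ = refl
pinchℕ-≤ {suc j} {suc v} (s≤s v≤j) = cong suc (pinchℕ-≤ v≤j)

pinchℕ-> : ∀ {j v} → j < v → pinchℕ j v ≡ pred v
pinchℕ-> {zero} {suc v} _ = refl
pinchℕ-> {suc j} {suc (suc v)} (s≤s j<v) = cong suc (pinchℕ-> j<v)

pinchℕ-mono-≤ : ∀ j {v w} → v ≤ w → pinchℕ j v ≤ pinchℕ j w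
pinchℕ-mono-≤ _ {zero} _ = z≤n
pinchℕ-mono-≤ zero {suc v} {suc w} (s≤s v≤w) = v≤w
pinchℕ-mono-≤ (suc j) {suc v} {suc w} (s≤s v≤w) = s≤s (pinchℕ-mono-≤ j v≤w)

pinchℕ-≤-pred : ∀ {j n w} → j ≤ n → w ≤ suc n → pinchℕ j w ≤ n
pinchℕ-≤-pred {j} {n} {w} j≤n w≤sn with <-cmp j w
... | tri< j<w _ _ rewrite pinchℕ-> j<w = pred-mono-≤ w≤sn
... | tri≈ _ refl _ rewrite pinchℕ-≤ (≤-refl {j}) = j≤n
... | tri> _ _ w<j rewrite pinchℕ-≤ (<⇒≤ w<j) = ≤-trans (<⇒≤ w<j) j≤n

contract≡pinchℕ : ∀ {n v} → v ≤ suc n → contract n n v ≡ pinchℕ n v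
contract≡pinchℕ {n} {v} v≤sn with <-cmp v n
... | tri< v<n _ _ = trans (contract-< v<n) (sym (pinchℕ-≤ (<⇒≤ v<n)))
... | tri≈ _ refl _ = trans (contract-self {v}) (sym (pinchℕ-≤ ≤-refl))
... | tri> _ _ n<v = trans (contract-> n<v) (sym (pinchℕ-> n<v))

-- The Petrie matrix and its minors

inInterval : ℕ → ℕ → ℕ → ℤ
inInterval zero zero j = + 0
inInterval zero (suc b) zero = + 1
inInterval zero (suc b) (suc j) = inInterval zero b j
inInterval (suc a) zero j = + 0
inInterval (suc a) (suc b) zero = + 0
inInterval (suc a) (suc b) (suc j) = inInterval a b j

inInterval-yes : ∀ a b j → a ≤ j → j < b → inInterval a b j ≡ + 1
inInterval-yes zero (suc b) zero _ _ = refl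
inInterval-yes zero (suc b) (suc j) _ (s≤s j<b) = inInterval-yes zero b j z≤n j<b
inInterval-yes (suc a) (suc b) (suc j) (s≤s a≤j) (s≤s j<b) = inInterval-yes a b j a≤j j<b

inInterval-no : ∀ a b j → ¬ (a ≤ j × j < b) → inInterval a b j ≡ + 0
inInterval-no zero zero j _ = refl
inInterval-no zero (suc b) zero ∉ = ⊥-elim (∉ (z≤n , z<s))
inInterval-no zero (suc b) (suc j) ∉ = inInterval-no zero b j (λ (_ , j<b) → ∉ (z≤n , s≤s j<b))
inInterval-no (suc a) zero j _ = refl
inInterval-no (suc a) (suc b) zero _ = refl
inInterval-no (suc a) (suc b) (suc j) ∉ = inInterval-no a b j (λ (a≤j , j<b) → ∉ (s≤s a≤j , s≤s j<b))

inInterval-punchInℕ : ∀ a b j s → inInterval a b (punchInℕ j s) ≡ inInterval (pinchℕ j a) (pinchℕ j b) s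
inInterval-punchInℕ zero zero j s = refl
inInterval-punchInℕ zero (suc b) zero s = refl
inInterval-punchInℕ (suc zero) zero zero s = refl
inInterval-punchInℕ (suc (suc a)) zero zero s = refl
inInterval-punchInℕ (suc a) (suc b) zero s = refl
inInterval-punchInℕ zero (suc b) (suc j) zero = refl
inInterval-punchInℕ (suc a) zero (suc j) zero = refl
inInterval-punchInℕ (suc a) (suc b) (suc j) zero = refl
inInterval-punchInℕ zero (suc b) (suc j) (suc s) = inInterval-punchInℕ zero b j s
inInterval-punchInℕ (suc a) zero (suc j) (suc s) = refl
inInterval-punchInℕ (suc a) (suc b) (suc j) (suc s) = inInterval-punchInℕ a b j s

petrie≡inInterval : ∀ n (a b : Fin n → ℕ) r j → petrie n a b r j ≡ inInterval (a r) (b r) (toℕ j)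
petrie≡inInterval n a b r j with (a r ≤? toℕ j) ×-dec (toℕ j <? b r)
... | yes (a≤j , j<b) = sym (inInterval-yes _ _ _ a≤j j<b)
... | no ∉ = sym (inInterval-no _ _ _ ∉)

petrie-minor : ∀ n (a b : Fin (suc n) → ℕ) (j : Fin (suc n)) r s →
  petrie (suc n) a b (suc r) (punchIn j s)
    ≡ petrie n (pinchℕ (toℕ j) ∘ a ∘ suc) (pinchℕ (toℕ j) ∘ b ∘ suc) r s
petrie-minor n a b j r s = begin
  petrie (suc n) a b (suc r) (punchIn j s)
    ≡⟨ petrie≡inInterval (suc n) a b (suc r) (punchIn j s) ⟩
  inInterval (a (suc r)) (b (suc r)) (toℕ (punchIn j s))
    ≡⟨ cong (inInterval (a (suc r)) (b (suc r))) (toℕ-punchIn j s) ⟩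
  inInterval (a (suc r)) (b (suc r)) (punchInℕ (toℕ j) (toℕ s))
    ≡⟨ inInterval-punchInℕ (a (suc r)) (b (suc r)) (toℕ j) (toℕ s) ⟩
  inInterval (pinchℕ (toℕ j) (a (suc r))) (pinchℕ (toℕ j) (b (suc r))) (toℕ s)
    ≡⟨ sym (petrie≡inInterval n _ _ r s) ⟩
  petrie n (pinchℕ (toℕ j) ∘ a ∘ suc) (pinchℕ (toℕ j) ∘ b ∘ suc) r s ∎
  where open ≡-Reasoning

det-cong : ∀ n {M M′ : Fin n → Fin n → ℤ} → (∀ r s → M r s ≡ M′ r s) → det n M ≡ det n M′
det-cong zero _ = refl
det-cong (suc n) M≡M′ = cong sumℤ (map-cong (λ j →
  cong₂ (λ m d → sgn (toℕ j) ℤ.* (m ℤ.* d)) (M≡M′ zero j) (det-cong n (λ r s → M≡M′ (suc r) (punchIn j s))))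
  (allFin (suc n)))

-- Sums

∑< : ℕ → (ℕ → ℤ) → ℤ
∑< zero g = + 0
∑< (suc m) g = g 0 ℤ.+ ∑< m (g ∘ suc)

infix 5 ∑<
syntax ∑< m (λ j → e) = ∑[ j < m ] e

∑<-zero : ∀ m (g : ℕ → ℤ) → (∀ j → g j ≡ + 0) → ∑< m g ≡ + 0
∑<-zero zero g _ = refl
∑<-zero (suc m) g g≡0 rewrite g≡0 0 | ∑<-zero m (g ∘ suc) (g≡0 ∘ suc) = refl

sumℤ-tabulate : ∀ {A : Set} m (h : Fin m → A) (f : A → ℤ) (g : ℕ → ℤ) → (∀ j → f (h j) ≡ g (toℕ j)) →
  sumℤ (map f (tabulate h)) ≡ ∑< m g
sumℤ-tabulate zero h f g _ = refl
sumℤ-tabulate (suc m) h f g f∘h≡g =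
  cong₂ ℤ._+_ (f∘h≡g zero) (sumℤ-tabulate m (h ∘ suc) f (g ∘ suc) (f∘h≡g ∘ suc))

sgn-+ : ∀ p q → sgn (p + q) ≡ sgn p ℤ.* sgn q
sgn-+ zero q = sym (ℤ.*-identityˡ (sgn q))
sgn-+ (suc p) q = trans (cong -_ (sgn-+ p q)) (ℤ.neg-distribˡ-* (sgn p) (sgn q))

module _ {A : Set} where

  sumℤ-++ : ∀ xs ys → sumℤ (xs ++ ys) ≡ sumℤ xs ℤ.+ sumℤ ys
  sumℤ-++ [] ys = sym (ℤ.+-identityˡ _)
  sumℤ-++ (x ∷ xs) ys = trans (cong (ℤ._+_ x) (sumℤ-++ xs ys)) (sym (ℤ.+-assoc x _ _))

  sumℤ-map-cong : ∀ {f g : A → ℤ} → (∀ x → f x ≡ g x) → ∀ xs → sumℤ (map f xs) ≡ sumℤ (map g xs)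
  sumℤ-map-cong f≡g xs = cong sumℤ (map-cong f≡g xs)

  sumℤ-map-0 : ∀ {f : A → ℤ} → (∀ x → f x ≡ + 0) → ∀ xs → sumℤ (map f xs) ≡ + 0
  sumℤ-map-0 f≡0 [] = refl
  sumℤ-map-0 f≡0 (x ∷ xs) rewrite f≡0 x | sumℤ-map-0 f≡0 xs = refl

  sumℤ-map-+ : ∀ (f g : A → ℤ) xs → sumℤ (map (λ x → f x ℤ.+ g x) xs) ≡ sumℤ (map f xs) ℤ.+ sumℤ (map g xs)
  sumℤ-map-+ f g [] = refl
  sumℤ-map-+ f g (x ∷ xs) rewrite sumℤ-map-+ f g xs = interchange (f x) (g x) _ _
    where
    interchange : ∀ a b c d → (a ℤ.+ b) ℤ.+ (c ℤ.+ d) ≡ (a ℤ.+ c) ℤ.+ (b ℤ.+ d)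
    interchange = solve-∀

  sumℤ-map-*ˡ : ∀ k (f : A → ℤ) xs → sumℤ (map (λ x → k ℤ.* f x) xs) ≡ k ℤ.* sumℤ (map f xs)
  sumℤ-map-*ˡ k f [] = sym (ℤ.*-zeroʳ k)
  sumℤ-map-*ˡ k f (x ∷ xs) rewrite sumℤ-map-*ˡ k f xs = sym (ℤ.*-distribˡ-+ k (f x) _)

  sumℤ-filter : ∀ {P : A → Set} (P? : Decidable P) (f : A → ℤ) xs →
    sumℤ (map f (filter P? xs)) ≡ sumℤ (map (λ x → if does (P? x) then f x else + 0) xs)
  sumℤ-filter P? f [] = refl
  sumℤ-filter P? f (x ∷ xs) with does (P? x)
  ... | true = cong (ℤ._+_ (f x)) (sumℤ-filter P? f xs)
  ... | false = trans (sumℤ-filter P? f xs) (sym (ℤ.+-identityˡ _))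

  sumℤ-concatMap : ∀ {B : Set} (F : A → List B) (f : B → ℤ) (g : A → ℤ) → (∀ x → sumℤ (map f (F x)) ≡ g x) →
    ∀ xs → sumℤ (map f (concatMap F xs)) ≡ sumℤ (map g xs)
  sumℤ-concatMap F f g sum≡g [] = refl
  sumℤ-concatMap F f g sum≡g (x ∷ xs) = begin
    sumℤ (map f (F x ++ concatMap F xs))               ≡⟨ cong sumℤ (map-++ f (F x) (concatMap F xs)) ⟩
    sumℤ (map f (F x) ++ map f (concatMap F xs))       ≡⟨ sumℤ-++ (map f (F x)) _ ⟩
    sumℤ (map f (F x)) ℤ.+ sumℤ (map f (concatMap F xs)) ≡⟨ cong₂ ℤ._+_ (sum≡g x) (sumℤ-concatMap F f g sum≡g xs) ⟩
    g x ℤ.+ sumℤ (map g xs)                              ∎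
    where open ≡-Reasoning

telescope : ∀ m (T F : ℕ → ℤ) → (∀ x → x < m → T x ℤ.- T (suc x) ≡ F x) →
  ∀ {a b} → a ≤ b → b ≤ m → T a ℤ.- T b ≡ ∑[ j < m ] inInterval a b j ℤ.* F j
telescope zero T F _ {zero} {zero} _ _ = ℤ.+-inverseʳ (T 0)
telescope (suc m) T F _ {zero} {zero} _ _ =
  trans (ℤ.+-inverseʳ (T 0)) (sym (∑<-zero (suc m) _ (λ _ → refl)))
telescope (suc m) T F step {zero} {suc b} _ (s≤s b≤m) = begin
  T 0 ℤ.- T (suc b)                          ≡⟨ split (T 0) (T 1) (T (suc b)) ⟩
  (T 0 ℤ.- T 1) ℤ.+ (T 1 ℤ.- T (suc b))      ≡⟨ cong₂ ℤ._+_ (trans (step 0 z<s) (sym (ℤ.*-identityˡ (F 0))))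
                                                             (telescope m (T ∘ suc) (F ∘ suc) step′ z≤n b≤m) ⟩
  ∑[ j < suc m ] inInterval 0 (suc b) j ℤ.* F j ∎
  where
  open ≡-Reasoning
  split : ∀ t₀ t₁ t → t₀ ℤ.- t ≡ (t₀ ℤ.- t₁) ℤ.+ (t₁ ℤ.- t)
  split = solve-∀
  step′ : ∀ x → x < m → T (suc x) ℤ.- T (suc (suc x)) ≡ F (suc x)
  step′ x x<m = step (suc x) (s≤s x<m)
telescope (suc m) T F step {suc a} {suc b} (s≤s a≤b) (s≤s b≤m) =
  trans (telescope m (T ∘ suc) (F ∘ suc) (λ x x<m → step (suc x) (s≤s x<m)) a≤b b≤m) (sym (ℤ.+-identityˡ _))

-- The signed count

-- signedCount k a b m concerns k rows on the vertices 0, …, m with sink m.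
mutual
  signedCount : (k : ℕ) → (Fin k → ℕ) → (Fin k → ℕ) → ℕ → ℤ
  signedCount zero a b zero = + 1
  signedCount zero a b (suc m) = + 0
  signedCount (suc k) a b zero = + 0
  signedCount (suc k) a b (suc m) =
    tailTerm k (a ∘ suc) (b ∘ suc) m (a zero) ℤ.- tailTerm k (a ∘ suc) (b ∘ suc) m (b zero)

  tailTerm : (k : ℕ) → (Fin k → ℕ) → (Fin k → ℕ) → ℕ → ℕ → ℤ
  tailTerm k a b m x =
    if x <ᵇ suc m then sgn x ℤ.* signedCount k (contract x m ∘ a) (contract x m ∘ b) m else + 0

signedCount-cong : ∀ k {a a′ b b′ : Fin k → ℕ} m → (∀ r → a r ≡ a′ r) → (∀ r → b r ≡ b′ r) →
  signedCount k a b m ≡ signedCount k a′ b′ m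
signedCount-cong zero zero _ _ = refl
signedCount-cong zero (suc m) _ _ = refl
signedCount-cong (suc k) zero _ _ = refl
signedCount-cong (suc k) {a} {a′} {b} {b′} (suc m) a≡a′ b≡b′ rewrite a≡a′ zero | b≡b′ zero =
  cong₂ ℤ._-_ (tail (a′ zero)) (tail (b′ zero))
  where
  tail : ∀ x → tailTerm k (a ∘ suc) (b ∘ suc) m x ≡ tailTerm k (a′ ∘ suc) (b′ ∘ suc) m x
  tail x = cong (λ g → if x <ᵇ suc m then sgn x ℤ.* g else + 0)
    (signedCount-cong k m (cong (contract x m) ∘ a≡a′ ∘ suc) (cong (contract x m) ∘ b≡b′ ∘ suc))

tailTerm-cong : ∀ k {a a′ b b′ : Fin k → ℕ} m x →
  (∀ r → contract x m (a r) ≡ contract x m (a′ r)) → (∀ r → contract x m (b r) ≡ contract x m (b′ r)) →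
  tailTerm k a b m x ≡ tailTerm k a′ b′ m x
tailTerm-cong k m x a≡a′ b≡b′ =
  cong (λ g → if x <ᵇ suc m then sgn x ℤ.* g else + 0) (signedCount-cong k m a≡a′ b≡b′)

-- Split j s u₁ u₂ u₃: an endpoint u₃ at the vertex j of the third graph stays at j
-- in one of the first two graphs and is moved to the sink s in the other.
data Split (j s : ℕ) : ℕ → ℕ → ℕ → Set where
  unsplit : ∀ {u} → u ≢ j → Split j s u u u
  kept₁ : Split j s j s j
  kept₂ : Split j s s j j

Split-contract : ∀ {j n u u₁ u₂ u₃} → j < suc n → u < suc n → u ≢ j → Split j (suc n) u₁ u₂ u₃ →
  Split (contract u n j) n (contract u n u₁) (contract u n u₂) (contract u n u₃)
Split-contract (s≤s j≤n) (s≤s u≤n) u≢j (unsplit w≢j) =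
  unsplit (w≢j ∘ contract-injective (u≢j ∘ sym) (contract-<-sink u≤n j≤n (u≢j ∘ sym)))
Split-contract {n = n} _ u<sn _ kept₁ rewrite contract-> {m = n} u<sn = kept₁
Split-contract {n = n} _ u<sn _ kept₂ rewrite contract-> {m = n} u<sn = kept₂

Split-contract₁₃ : ∀ {j n u₁ u₂ u₃} → j < suc n → Split j (suc n) u₁ u₂ u₃ →
  contract j n u₁ ≡ contract j n u₃
Split-contract₁₃ _ (unsplit _) = refl
Split-contract₁₃ _ kept₁ = refl
Split-contract₁₃ {j} {n} j<sn kept₂ = trans (contract-> j<sn) (sym (contract-self {j}))

Split-contract₂₃ : ∀ {j n u₁ u₂ u₃} → j < suc n → Split j (suc n) u₁ u₂ u₃ →
  contract j n u₂ ≡ contract j n u₃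
Split-contract₂₃ _ (unsplit _) = refl
Split-contract₂₃ {j} {n} j<sn kept₁ = trans (contract-> j<sn) (sym (contract-self {j}))
Split-contract₂₃ _ kept₂ = refl

signedCount-split : ∀ k {n j} → j < n → {a₁ b₁ a₂ b₂ a₃ b₃ : Fin k → ℕ} →
  (∀ r → Split j n (a₁ r) (a₂ r) (a₃ r)) → (∀ r → Split j n (b₁ r) (b₂ r) (b₃ r)) →
  signedCount k a₁ b₁ n ℤ.+ signedCount k a₂ b₂ n ≡ signedCount k a₃ b₃ n
signedCount-split zero {suc n} _ _ _ = refl
signedCount-split (suc k) {suc n} {j} j<sn {a₁} {b₁} {a₂} {b₂} {a₃} {b₃} splitₐ splitᵦ =
  begin
    (T₁ (a₁ zero) ℤ.- T₁ (b₁ zero)) ℤ.+ (T₂ (a₂ zero) ℤ.- T₂ (b₂ zero))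
      ≡⟨ rearrange (T₁ (a₁ zero)) (T₂ (a₂ zero)) (T₁ (b₁ zero)) (T₂ (b₂ zero)) ⟩
    (T₁ (a₁ zero) ℤ.+ T₂ (a₂ zero)) ℤ.- (T₁ (b₁ zero) ℤ.+ T₂ (b₂ zero))
      ≡⟨ cong₂ ℤ._-_ (tail-split (splitₐ zero)) (tail-split (splitᵦ zero)) ⟩
    T₃ (a₃ zero) ℤ.- T₃ (b₃ zero) ∎
  where
  open ≡-Reasoning
  T₁ T₂ T₃ : ℕ → ℤ
  T₁ = tailTerm k (a₁ ∘ suc) (b₁ ∘ suc) n
  T₂ = tailTerm k (a₂ ∘ suc) (b₂ ∘ suc) n
  T₃ = tailTerm k (a₃ ∘ suc) (b₃ ∘ suc) n
  rearrange : ∀ a b c d → (a ℤ.- c) ℤ.+ (b ℤ.- d) ≡ (a ℤ.+ b) ℤ.- (c ℤ.+ d)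
  rearrange = solve-∀
  tail-split : ∀ {u₁ u₂ u₃} → Split j (suc n) u₁ u₂ u₃ → T₁ u₁ ℤ.+ T₂ u₂ ≡ T₃ u₃
  tail-split (unsplit {u} u≢j) with u <ᵇ suc n | <ᵇ-reflects-< u (suc n)
  ... | false | _ = refl
  ... | true | ofʸ u<sn@(s≤s u≤n) =
    trans (sym (ℤ.*-distribˡ-+ (sgn u) _ _)) (cong (sgn u ℤ.*_)
      (signedCount-split k (contract-<-sink u≤n (≤-pred j<sn) (u≢j ∘ sym))
        (Split-contract j<sn u<sn u≢j ∘ splitₐ ∘ suc) (Split-contract j<sn u<sn u≢j ∘ splitᵦ ∘ suc)))
  tail-split kept₁ rewrite <ᵇ-false (n≮n (suc n)) = trans (ℤ.+-identityʳ _)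
    (tailTerm-cong k n j (Split-contract₁₃ j<sn ∘ splitₐ ∘ suc) (Split-contract₁₃ j<sn ∘ splitᵦ ∘ suc))
  tail-split kept₂ rewrite <ᵇ-false (n≮n (suc n)) = trans (ℤ.+-identityˡ _)
    (tailTerm-cong k n j (Split-contract₂₃ j<sn ∘ splitₐ ∘ suc) (Split-contract₂₃ j<sn ∘ splitᵦ ∘ suc))

Split-contract-pinchℕ : ∀ {x n v} → x < n → v ≤ suc n →
  Split x n (contract x n v) (contract (suc x) n v) (pinchℕ x v)
Split-contract-pinchℕ {x} {n} {v} x<n v≤sn with <-cmp v x
... | tri< v<x _ _ rewrite contract-< {m = n} v<x | contract-< {m = n} (m<n⇒m<1+n v<x) | pinchℕ-≤ (<⇒≤ v<x) =
  unsplit (<⇒≢ v<x)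
... | tri≈ _ refl _ rewrite contract-self {v} {n} | contract-< {m = n} (n<1+n v) | pinchℕ-≤ (≤-refl {v}) = kept₂
... | tri> _ _ x<v with <-cmp v (suc x)
...   | tri< v<sx _ _ = ⊥-elim (<⇒≱ x<v (≤-pred v<sx))
...   | tri≈ _ refl _ rewrite contract-> {m = n} x<v | contract-self {v} {n} | pinchℕ-> x<v = kept₁
...   | tri> _ _ sx<v rewrite contract-> {m = n} x<v | contract-> {m = n} sx<v | pinchℕ-> x<v =
  unsplit (λ { refl → n≮n _ (<⇒≤pred sx<v) })

tailTerm-step : ∀ n (a b : Fin n → ℕ) x → x < suc n → (∀ r → a r ≤ suc n) → (∀ r → b r ≤ suc n) →
  tailTerm n a b n x ℤ.- tailTerm n a b n (suc x) ≡ sgn x ℤ.* signedCount n (pinchℕ x ∘ a) (pinchℕ x ∘ b) n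
tailTerm-step n a b x x<sn a≤sn b≤sn with m≤n⇒m<n∨m≡n (≤-pred x<sn)
... | inj₁ x<n rewrite <ᵇ-true x<sn | <ᵇ-true (s≤s x<n) =
  trans (factor (sgn x) _ _)
    (cong (sgn x ℤ.*_) (signedCount-split n x<n (Split-contract-pinchℕ x<n ∘ a≤sn) (Split-contract-pinchℕ x<n ∘ b≤sn)))
  where
  factor : ∀ s g₁ g₂ → s ℤ.* g₁ ℤ.- (ℤ.- s) ℤ.* g₂ ≡ s ℤ.* (g₁ ℤ.+ g₂)
  factor = solve-∀
... | inj₂ refl rewrite <ᵇ-true x<sn | <ᵇ-false (n≮n (suc x)) =
  trans (ℤ.+-identityʳ _)
    (cong (sgn x ℤ.*_) (signedCount-cong x x (contract≡pinchℕ ∘ a≤sn) (contract≡pinchℕ ∘ b≤sn)))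

det-petrie : ∀ n (a b : Fin n → ℕ) → (∀ r → a r ≤ b r) → (∀ r → b r ≤ n) →
  det n (petrie n a b) ≡ signedCount n a b n
det-petrie zero _ _ _ _ = refl
det-petrie (suc n) a b a≤b b≤n = begin
  det (suc n) (petrie (suc n) a b)
    ≡⟨ sumℤ-tabulate (suc n) id _ (λ j → inInterval (a zero) (b zero) j ℤ.* F j) expand ⟩
  ∑[ j < suc n ] inInterval (a zero) (b zero) j ℤ.* F j
    ≡⟨ sym (telescope (suc n) T F step (a≤b zero) (b≤n zero)) ⟩
  T (a zero) ℤ.- T (b zero) ∎
  where
  open ≡-Reasoning
  T F : ℕ → ℤ
  T = tailTerm n (a ∘ suc) (b ∘ suc) n
  F x = sgn x ℤ.* signedCount n (pinchℕ x ∘ a ∘ suc) (pinchℕ x ∘ b ∘ suc) n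
  step : ∀ x → x < suc n → T x ℤ.- T (suc x) ≡ F x
  step x x<sn = tailTerm-step n (a ∘ suc) (b ∘ suc) x x<sn (λ r → ≤-trans (a≤b (suc r)) (b≤n (suc r))) (b≤n ∘ suc)
  Minor : Fin (suc n) → Fin n → Fin n → ℤ
  Minor j r s = petrie (suc n) a b (suc r) (punchIn j s)
  det-Minor : ∀ j → det n (Minor j) ≡ signedCount n (pinchℕ (toℕ j) ∘ a ∘ suc) (pinchℕ (toℕ j) ∘ b ∘ suc) n
  det-Minor j = trans (det-cong n (petrie-minor n a b j))
    (det-petrie n _ _ (pinchℕ-mono-≤ (toℕ j) ∘ a≤b ∘ suc) (pinchℕ-≤-pred (≤-pred (toℕ<n j)) ∘ b≤n ∘ suc))
  expand : ∀ j → sgn (toℕ j) ℤ.* (petrie (suc n) a b zero j ℤ.* det n (Minor j))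
                 ≡ inInterval (a zero) (b zero) (toℕ j) ℤ.* F (toℕ j)
  expand j = begin
    sgn (toℕ j) ℤ.* (petrie (suc n) a b zero j ℤ.* det n (Minor j))
      ≡⟨ swap (sgn (toℕ j)) (petrie (suc n) a b zero j) (det n (Minor j)) ⟩
    petrie (suc n) a b zero j ℤ.* (sgn (toℕ j) ℤ.* det n (Minor j))
      ≡⟨ cong₂ ℤ._*_ (petrie≡inInterval (suc n) a b zero j) (cong (sgn (toℕ j) ℤ.*_) (det-Minor j)) ⟩
    inInterval (a zero) (b zero) (toℕ j) ℤ.* F (toℕ j) ∎
    where
    swap : ∀ s p d → s ℤ.* (p ℤ.* d) ≡ p ℤ.* (s ℤ.* d)
    swap = solve-∀

-- Permutations and inversions

-- permᵇ w m decides w ↭ upTo m by the same recursion as signedCount.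
permᵇ : List ℕ → ℕ → Bool
permᵇ [] zero = true
permᵇ [] (suc m) = false
permᵇ (x ∷ w) zero = false
permᵇ (x ∷ w) (suc m) = (x <ᵇ suc m) ∧ permᵇ (map (contract x m) w) m

upTo-suc : ∀ m → upTo (suc m) ≡ 0 ∷ map suc (upTo m)
upTo-suc m = cong (0 ∷_) (sym (map-upTo suc m))

punchInℕ-upTo : ∀ {x m} → x ≤ m → x ∷ map (punchInℕ x) (upTo m) ↭ upTo (suc m)
punchInℕ-upTo {zero} {m} _ = ↭-reflexive (sym (upTo-suc m))
punchInℕ-upTo {suc x} {suc m} (s≤s x≤m) = begin
  suc x ∷ map (punchInℕ (suc x)) (upTo (suc m))
    ≡⟨ cong (λ l → suc x ∷ map (punchInℕ (suc x)) l) (upTo-suc m) ⟩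
  suc x ∷ 0 ∷ map (punchInℕ (suc x)) (map suc (upTo m))
    ≡⟨ cong (λ l → suc x ∷ 0 ∷ l) (trans (sym (map-∘ (upTo m))) (map-∘ (upTo m))) ⟩
  suc x ∷ 0 ∷ map suc (map (punchInℕ x) (upTo m))         ↭⟨ ↭-swap (suc x) 0 ↭-refl ⟩
  0 ∷ map suc (x ∷ map (punchInℕ x) (upTo m))             ↭⟨ ↭-prep 0 (map⁺ suc (punchInℕ-upTo x≤m)) ⟩
  0 ∷ map suc (upTo (suc m))                              ≡⟨ sym (upTo-suc (suc m)) ⟩
  upTo (suc (suc m))                                      ∎
  where open PermutationReasoning

↭upTo⇒All< : ∀ {w m} → w ↭ upTo m → All (_< m) w
↭upTo⇒All< w↭ = All.tabulate (∈-upTo⁻ ∘ ∈-resp-↭ w↭)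

contract-↭upTo⇒≢ : ∀ {x m w} → map (contract x m) w ↭ upTo m → All (_≢ x) w
contract-↭upTo⇒≢ c[w]↭ = All.map contract-<-sink⇒≢ (map⁻ (↭upTo⇒All< c[w]↭))

↭upTo-∷ : ∀ {x m w} → x ≤ m → map (contract x m) w ↭ upTo m → x ∷ w ↭ upTo (suc m)
↭upTo-∷ {x} {m} {w} x≤m c[w]↭ = begin
  x ∷ w                                        ≡⟨ cong (x ∷_) (sym w≡) ⟩
  x ∷ map (punchInℕ x) (map (contract x m) w)  ↭⟨ ↭-prep x (map⁺ (punchInℕ x) c[w]↭) ⟩
  x ∷ map (punchInℕ x) (upTo m)                ↭⟨ punchInℕ-upTo x≤m ⟩
  upTo (suc m)                                 ∎
  where
  open PermutationReasoning
  w≡ : map (punchInℕ x) (map (contract x m) w) ≡ w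
  w≡ = trans (sym (map-∘ w)) (map-id-local (All.map (punchInℕ-contract {x} {m}) (contract-↭upTo⇒≢ c[w]↭)))

↭upTo-∷⁻ : ∀ {x m w} → x ∷ w ↭ upTo (suc m) → x < suc m × map (contract x m) w ↭ upTo m
↭upTo-∷⁻ {x} {m} {w} x∷w↭ = x<sm , (begin
  map (contract x m) w                          ↭⟨ map⁺ (contract x m) w↭ ⟩
  map (contract x m) (map (punchInℕ x) (upTo m))
    ≡⟨ trans (sym (map-∘ (upTo m))) (trans (map-cong (contract-punchInℕ {x} {m}) (upTo m)) (map-id (upTo m))) ⟩
  upTo m                                        ∎)
  where
  open PermutationReasoning
  x<sm : x < suc m
  x<sm = ∈-upTo⁻ (∈-resp-↭ x∷w↭ (here refl))
  w↭ : w ↭ map (punchInℕ x) (upTo m)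
  w↭ = drop-∷ (↭-trans x∷w↭ (↭-sym (punchInℕ-upTo (≤-pred x<sm))))

permᵇ⇒↭ : ∀ w m → permᵇ w m ≡ true → w ↭ upTo m
permᵇ⇒↭ [] zero _ = ↭-refl
permᵇ⇒↭ (x ∷ w) (suc m) h with x <ᵇ suc m | <ᵇ-reflects-< x (suc m)
permᵇ⇒↭ (x ∷ w) (suc m) h  | true | ofʸ (s≤s x≤m) = ↭upTo-∷ x≤m (permᵇ⇒↭ (map (contract x m) w) m h)
permᵇ⇒↭ (x ∷ w) (suc m) () | false | _

↭⇒permᵇ : ∀ w m → w ↭ upTo m → permᵇ w m ≡ true
↭⇒permᵇ [] zero _ = refl
↭⇒permᵇ [] (suc m) []↭ with () ← ↭-length []↭
↭⇒permᵇ (x ∷ w) zero x∷w↭ with () ← ↭-length x∷w↭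
↭⇒permᵇ (x ∷ w) (suc m) x∷w↭ with ↭upTo-∷⁻ x∷w↭
... | x<sm , c[w]↭ rewrite <ᵇ-true x<sm = ↭⇒permᵇ (map (contract x m) w) m c[w]↭

countBelow : ℕ → List ℕ → ℕ
countBelow k w = length (filter (_<? k) w)

countBelow-∷-< : ∀ {k v} w → v < k → countBelow k (v ∷ w) ≡ suc (countBelow k w)
countBelow-∷-< {k} _ v<k = cong length (filter-accept (_<? k) v<k)

countBelow-∷-≮ : ∀ {k v} w → ¬ v < k → countBelow k (v ∷ w) ≡ countBelow k w
countBelow-∷-≮ {k} _ v≮k = cong length (filter-reject (_<? k) v≮k)

countBelow-map : ∀ {k k′} (f : ℕ → ℕ) {w} → All (λ v → v < k ⇔ f v < k′) w →
  countBelow k w ≡ countBelow k′ (map f w)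
countBelow-map f [] = refl
countBelow-map {k} {k′} f {v ∷ w} (v⇔ ∷ w⇔) with v <? k
... | yes v<k = trans (countBelow-∷-< w v<k) (trans (cong suc (countBelow-map f w⇔)) (sym (countBelow-∷-< _ (to v⇔ v<k))))
... | no v≮k = trans (countBelow-∷-≮ w v≮k) (trans (countBelow-map f w⇔) (sym (countBelow-∷-≮ _ (v≮k ∘ from v⇔))))

countBelow-↭ : ∀ k {w w′} → w ↭ w′ → countBelow k w ≡ countBelow k w′
countBelow-↭ k w↭w′ = ↭-length (filter-↭ (_<? k) w↭w′)

countBelow-upTo : ∀ k m → k ≤ m → countBelow k (upTo m) ≡ k
countBelow-upTo zero m _ = cong length (filter-none (_<? 0) (All.universal (λ _ ()) (upTo m)))
countBelow-upTo (suc k) (suc m) (s≤s k≤m) = begin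
  countBelow (suc k) (upTo (suc m))            ≡⟨ cong (countBelow (suc k)) (upTo-suc m) ⟩
  suc (countBelow (suc k) (map suc (upTo m)))
    ≡⟨ cong suc (sym (countBelow-map suc (All.universal (λ _ → mk⇔ s≤s ≤-pred) (upTo m)))) ⟩
  suc (countBelow k (upTo m))                  ≡⟨ cong suc (countBelow-upTo k m k≤m) ⟩
  suc k                                        ∎
  where open ≡-Reasoning

inversions-map : ∀ {P : ℕ → Set} (f : ℕ → ℕ) → (∀ {y z} → P y → P z → (z < y ⇔ f z < f y)) →
  ∀ {w} → All P w → inversions (map f w) ≡ inversions w
inversions-map f _ [] = refl
inversions-map f mono (py ∷ pw) = cong₂ _+_ (sym (countBelow-map f (All.map (mono py) pw))) (inversions-map f mono pw)

inversions-∷ : ∀ {x m w} → x ≤ m → map (contract x m) w ↭ upTo m →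
  inversions (x ∷ w) ≡ x + inversions (map (contract x m) w)
inversions-∷ {x} {m} {w} x≤m c[w]↭ = cong₂ _+_ countBelow-head
  (sym (inversions-map (contract x m) (contract-monotone {x} {m}) (contract-↭upTo⇒≢ c[w]↭)))
  where
  open ≡-Reasoning
  countBelow-head : countBelow x w ≡ x
  countBelow-head = begin
    countBelow x w             ≡⟨ sym (countBelow-∷-≮ w (n≮n x)) ⟩
    countBelow x (x ∷ w)       ≡⟨ countBelow-↭ x (↭upTo-∷ x≤m c[w]↭) ⟩
    countBelow x (upTo (suc m)) ≡⟨ countBelow-upTo x (suc m) (m≤n⇒m≤1+n x≤m) ⟩
    x                          ∎

-- Orientations

Extends : ∀ {n} → Bool → Orientation n → Orientation (suc n) → Set
Extends β σ τ = τ zero ≡ β × (∀ r → τ (suc r) ≡ σ r)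

sum-allOrientations-suc : ∀ n (f : Orientation (suc n) → ℤ) (g : Bool → Orientation n → ℤ) →
  (∀ {β σ τ} → Extends β σ τ → f τ ≡ g β σ) →
  sumℤ (map f (allOrientations (suc n))) ≡ sumℤ (map (λ σ → g false σ ℤ.+ g true σ) (allOrientations n))
sum-allOrientations-suc n f g f≡g = sumℤ-concatMap _ f _
  (λ σ → cong₂ ℤ._+_ (f≡g (refl , λ _ → refl)) (trans (ℤ.+-identityʳ _) (f≡g (refl , λ _ → refl))))
  (allOrientations n)

bit : Bool → ℕ
bit false = 0
bit true = 1

length-filter-tabulate : ∀ {n} {A B : Set} (f : A → Bool) (g : B → Bool) (h : Fin n → A) (h′ : Fin n → B) →
  (∀ r → f (h r) ≡ g (h′ r)) →
  length (filter (λ x → f x Bool.≟ true) (tabulate h)) ≡ length (filter (λ y → g y Bool.≟ true) (tabulate h′))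
length-filter-tabulate {zero} f g h h′ _ = refl
length-filter-tabulate {suc n} f g h h′ f≡g =
  cons (f≡g zero) (length-filter-tabulate f g (h ∘ suc) (h′ ∘ suc) (f≡g ∘ suc))
  where
  cons : ∀ {x y xs ys} → f x ≡ g y →
    length (filter (λ x → f x Bool.≟ true) xs) ≡ length (filter (λ y → g y Bool.≟ true) ys) →
    length (filter (λ x → f x Bool.≟ true) (x ∷ xs)) ≡ length (filter (λ y → g y Bool.≟ true) (y ∷ ys))
  cons {y = y} fx≡gy ih rewrite fx≡gy with g y
  ... | true = cong suc ih
  ... | false = ih

size-extend : ∀ {n β} {σ : Orientation n} {τ} → Extends β σ τ → size τ ≡ bit β + size σ
size-extend {β = β} {σ} {τ} (τ₀≡β , τ∘suc≡σ) rewrite τ₀≡β with β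
... | true = cong suc (length-filter-tabulate τ σ suc id τ∘suc≡σ)
... | false = length-filter-tabulate τ σ suc id τ∘suc≡σ

cWord-extend : ∀ {n} (a b : Fin (suc n) → ℕ) {β σ τ} → Extends β σ τ →
  cWord a b τ ≡ (if β then b zero else a zero) ∷ cWord (a ∘ suc) (b ∘ suc) σ
cWord-extend a b {σ = σ} {τ} (τ₀≡β , τ∘suc≡σ) =
  cong₂ _∷_ (cong (λ β → if β then b zero else a zero) τ₀≡β) (begin
  map (cOf a b τ) (tabulate suc)        ≡⟨ map-tabulate suc (cOf a b τ) ⟩
  tabulate (cOf a b τ ∘ suc)
    ≡⟨ tabulate-cong (λ r → cong (λ β → if β then b (suc r) else a (suc r)) (τ∘suc≡σ r)) ⟩
  tabulate (cOf (a ∘ suc) (b ∘ suc) σ)  ≡⟨ sym (map-tabulate id _) ⟩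
  cWord (a ∘ suc) (b ∘ suc) σ           ∎)
  where open ≡-Reasoning

map-cWord : ∀ {n} (f : ℕ → ℕ) (a b : Fin n → ℕ) σ → map f (cWord a b σ) ≡ cWord (f ∘ a) (f ∘ b) σ
map-cWord {n} f a b σ = trans (sym (map-∘ (allFin n))) (map-cong (λ r → if-float f (σ r)) (allFin n))

wordSign : ℕ → List ℕ → ℕ → ℤ
wordSign s w m = if permᵇ w m then sgn (s + inversions w) else + 0

goodSign : ∀ {n} → (a b : Fin n → ℕ) → ℕ → Orientation n → ℤ
goodSign a b m σ = wordSign (size σ) (cWord a b σ) m

wordSign-∷ : ∀ t s x m w →
  wordSign (t + s) (x ∷ w) (suc m)
    ≡ (if x <ᵇ suc m then sgn (t + x) ℤ.* wordSign s (map (contract x m) w) m else + 0)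
wordSign-∷ t s x m w with x <ᵇ suc m | <ᵇ-reflects-< x (suc m)
... | false | _ = refl
... | true | ofʸ (s≤s x≤m) with permᵇ (map (contract x m) w) m in perm
...   | false = sym (ℤ.*-zeroʳ (sgn (t + x)))
...   | true = begin
  sgn ((t + s) + inversions (x ∷ w))
    ≡⟨ cong (λ j → sgn ((t + s) + j)) (inversions-∷ {x} {m} {w} x≤m (permᵇ⇒↭ _ _ perm)) ⟩
  sgn ((t + s) + (x + i))             ≡⟨ cong sgn (interchange t s x i) ⟩
  sgn ((t + x) + (s + i))             ≡⟨ sgn-+ (t + x) (s + i) ⟩
  sgn (t + x) ℤ.* sgn (s + i)         ∎
  where
  open ≡-Reasoning
  i = inversions (map (contract x m) w)
  interchange : ∀ a b c d → (a + b) + (c + d) ≡ (a + c) + (b + d)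
  interchange = ℕ-Solver.solve-∀

goodSign-extend : ∀ {n} (a b : Fin (suc n) → ℕ) m {β σ τ} → Extends β σ τ →
  let x = if β then b zero else a zero in
  goodSign a b (suc m) τ
    ≡ (if x <ᵇ suc m then sgn (bit β + x) ℤ.* goodSign (contract x m ∘ a ∘ suc) (contract x m ∘ b ∘ suc) m σ else + 0)
goodSign-extend {n} a b m {β} {σ} {τ} τ≈βσ = begin
  wordSign (size τ) (cWord a b τ) (suc m)
    ≡⟨ cong₂ (λ s w → wordSign s w (suc m))
             (size-extend {n} {β} {σ} {τ} τ≈βσ) (cWord-extend a b {β} {σ} {τ} τ≈βσ) ⟩
  wordSign (bit β + size σ) (x ∷ W) (suc m)
    ≡⟨ wordSign-∷ (bit β) (size σ) x m W ⟩
  (if x <ᵇ suc m then sgn (bit β + x) ℤ.* wordSign (size σ) (map (contract x m) W) m else + 0)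
    ≡⟨ cong (λ w → if x <ᵇ suc m then sgn (bit β + x) ℤ.* wordSign (size σ) w m else + 0)
            (map-cWord (contract x m) _ _ σ) ⟩
  (if x <ᵇ suc m then sgn (bit β + x) ℤ.* goodSign (contract x m ∘ a ∘ suc) (contract x m ∘ b ∘ suc) m σ else + 0) ∎
  where
  open ≡-Reasoning
  W = cWord (a ∘ suc) (b ∘ suc) σ
  x = if β then b zero else a zero

sum-goodSign : ∀ n (a b : Fin n → ℕ) m → sumℤ (map (goodSign a b m) (allOrientations n)) ≡ signedCount n a b m
sum-goodSign zero a b zero = refl
sum-goodSign zero a b (suc m) = refl
sum-goodSign (suc n) a b zero = sumℤ-map-0 (λ _ → refl) (allOrientations (suc n))
sum-goodSign (suc n) a b (suc m) = begin
  sumℤ (map (goodSign a b (suc m)) (allOrientations (suc n)))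
    ≡⟨ sum-allOrientations-suc n _ G (λ {β} {σ} {τ} → goodSign-extend a b m {β} {σ} {τ}) ⟩
  sumℤ (map (λ σ → G false σ ℤ.+ G true σ) L)         ≡⟨ sumℤ-map-+ (G false) (G true) L ⟩
  sumℤ (map (G false) L) ℤ.+ sumℤ (map (G true) L)    ≡⟨ cong₂ ℤ._+_ (sum-G false) (sum-G true) ⟩
  sgn 0 ℤ.* T (a zero) ℤ.+ sgn 1 ℤ.* T (b zero)       ≡⟨ signs (T (a zero)) (T (b zero)) ⟩
  T (a zero) ℤ.- T (b zero)                           ∎
  where
  open ≡-Reasoning
  L = allOrientations n
  T = tailTerm n (a ∘ suc) (b ∘ suc) m
  x : Bool → ℕ
  x β = if β then b zero else a zero
  a′ b′ : Bool → Fin n → ℕ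
  a′ β = contract (x β) m ∘ a ∘ suc
  b′ β = contract (x β) m ∘ b ∘ suc
  G : Bool → Orientation n → ℤ
  G β σ = if x β <ᵇ suc m then sgn (bit β + x β) ℤ.* goodSign (a′ β) (b′ β) m σ else + 0
  sum-G : ∀ β → sumℤ (map (G β) L) ≡ sgn (bit β) ℤ.* T (x β)
  sum-G β with x β <ᵇ suc m
  ... | false = trans (sumℤ-map-0 (λ _ → refl) L) (sym (ℤ.*-zeroʳ (sgn (bit β))))
  ... | true = begin
    sumℤ (map (λ σ → s ℤ.* goodSign (a′ β) (b′ β) m σ) L)  ≡⟨ sumℤ-map-*ˡ s (goodSign (a′ β) (b′ β) m) L ⟩
    s ℤ.* sumℤ (map (goodSign (a′ β) (b′ β) m) L)          ≡⟨ cong (s ℤ.*_) (sum-goodSign n (a′ β) (b′ β) m) ⟩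
    s ℤ.* S                                                ≡⟨ cong (ℤ._* S) (sgn-+ (bit β) (x β)) ⟩
    sgn (bit β) ℤ.* sgn (x β) ℤ.* S                        ≡⟨ ℤ.*-assoc (sgn (bit β)) (sgn (x β)) S ⟩
    sgn (bit β) ℤ.* (sgn (x β) ℤ.* S)                      ∎
    where
    s = sgn (bit β + x β)
    S = signedCount n (a′ β) (b′ β) m
  signs : ∀ p q → sgn 0 ℤ.* p ℤ.+ sgn 1 ℤ.* q ≡ p ℤ.- q
  signs = solve-∀

does-Good : ∀ {n} (a b : Fin n → ℕ) σ (good? : Dec (Good a b σ)) → does good? ≡ permᵇ (cWord a b σ) n
does-Good {n} a b σ (yes good) = sym (↭⇒permᵇ (cWord a b σ) n good)
does-Good {n} a b σ (no ¬good) with permᵇ (cWord a b σ) n in perm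
... | true = ⊥-elim (¬good (permᵇ⇒↭ (cWord a b σ) n perm))
... | false = refl

theorem1p3 : (n : ℕ) → 1 ≤ n → (a b : Fin n → ℕ) →
    (∀ r → a r ≤ b r) → (∀ r → b r ≤ n) →
    (good? : Decidable (Good a b)) →
    det n (petrie n a b)
      ≡ sumℤ (map (λ σ → sgn (size σ + inv a b σ)) (filter good? (allOrientations n)))
theorem1p3 n _ a b a≤b b≤n good? = begin
  det n (petrie n a b)                                                 ≡⟨ det-petrie n a b a≤b b≤n ⟩
  signedCount n a b n                                                  ≡⟨ sym (sum-goodSign n a b n) ⟩
  sumℤ (map (goodSign a b n) L)                                        ≡⟨ sumℤ-map-cong signs-agree L ⟩
  sumℤ (map (λ σ → if does (good? σ) then sgn (size σ + inv a b σ) else + 0) L) ≡⟨ sym (sumℤ-filter good? _ L) ⟩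
  sumℤ (map (λ σ → sgn (size σ + inv a b σ)) (filter good? L))         ∎
  where
  open ≡-Reasoning
  L = allOrientations n
  signs-agree : ∀ σ → goodSign a b n σ ≡ (if does (good? σ) then sgn (size σ + inv a b σ) else + 0)
  signs-agree σ = cong (λ c → if c then sgn (size σ + inv a b σ) else + 0) (sym (does-Good a b σ (good? σ)))
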